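{- There is a split graph $G$ such that $|V(\mathcal{H}(G))|\ge 2^{n/6}+2n/3-2$, where $n=|V(G)|$.
   Context: A split graph is a graph whose vertex set can be partitioned into a clique and an independent set. A graph is Helly if every family of pairwise intersecting disks $D(v,r)=\{u:d(u,v)\le r\}$ (shortest-path metric) has a common vertex. The injective hull $\mathcal{H}(G)$ of a connected graph $G$ is the unique minimal Helly graph containing $G$ as an isometric subgraph (equivalently, the graph on functions $f:V(G)\to\mathbb{Z}_{\ge0}$ with $f(x)+f(y)\ge d_G(x,y)$ for all $x,y$ and for each $x$ some $y$ with equality, adjacency meaning sup-norm distance 1). -}

module Defs where

open import Data.Nat using (ℕ; zero; suc; _+_; _*_; _∸_; _^_; _≤_)
open import Data.Fin using (Fin)
open import Data.Bool using (Bool; true; false)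
open import Data.Product using (Σ; ∃; _×_; _,_)
open import Relation.Nullary using (¬_)
open import Relation.Binary.PropositionalEquality using (_≡_; _≢_)

record Graph : Set₁ where
  field
    n      : ℕ
    E      : Fin n → Fin n → Set
    E-sym  : ∀ {x y} → E x y → E y x
    E-irr  : ∀ {x} → ¬ E x x
open Graph public

data Walk (G : Graph) : Fin (n G) → Fin (n G) → ℕ → Set where
  here : ∀ {x} → Walk G x x 0
  step : ∀ {x y z k} → E G x y → Walk G y z k → Walk G x z (suc k)

IsDist : (G : Graph) → Fin (n G) → Fin (n G) → ℕ → Set
IsDist G x y k = Walk G x y k × (∀ j → Walk G x y j → k ≤ j)

Connected : Graph → Set
Connected G = ∀ x y → ∃ λ k → Walk G x y k

IsSplit : Graph → Set
IsSplit G = Σ (Fin (n G) → Bool) λ C →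
  (∀ x y → C x ≡ true → C y ≡ true → x ≢ y → E G x y) ×
  (∀ x y → C x ≡ false → C y ≡ false → ¬ E G x y)

HullVertex : (G : Graph) → (Fin (n G) → ℕ) → Set
HullVertex G f =
  (∀ x y k → IsDist G x y k → k ≤ f x + f y) ×
  (∀ x → ∃ λ y → IsDist G x y (f x + f y))

HullSizeAtLeast : (G : Graph) → ℕ → Set
HullSizeAtLeast G N = Σ (Fin N → Fin (n G) → ℕ) λ h →
  (∀ i → HullVertex G (h i)) ×
  (∀ i j → (∀ x → h i x ≡ h j x) → i ≡ j)

-- N ≥ 2^(n/6) + 2n/3 - 2 (real arithmetic), encoded exactly over ℕ:
-- equivalent to 3N + 6 - 2n ≥ 3·2^(n/6) ≥ 0, i.e.
-- 2n ≤ 3N + 6 and 3^6 · 2^n ≤ (3N + 6 - 2n)^6.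
BoundHolds : ℕ → ℕ → Set
BoundHolds n N = (2 * n ≤ 3 * N + 6) × (729 * 2 ^ n ≤ (3 * N + 6 ∸ 2 * n) ^ 6)

module Submission where

-- For an index set I = Fin K the graph has a clique consisting of two
-- vertices u₊, u₋ and the vertices w(i,δ) (i ∈ I, δ a sign), and an
-- independent set of vertices s(i,ε).  The vertex s(i,ε) is adjacent to
-- u_ε, to w(i,ε), and to w(j,¬ε) for every j ≠ i.  Any two vertices then
-- have a common neighbour, except the antipodal pairs s(i,ε), s(i,¬ε),
-- which are at distance 3.  For a sign vector σ : I → Bool let f_σ be 1
-- on the clique and on s(i,σᵢ), and 2 on s(i,¬σᵢ).  Then f_σ dominates
-- the metric, and if every sign occurs in σ away from every index, each
-- vertex has a partner realising f_σ(x) + f_σ(y) = d(x,y): f_σ is a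
-- vertex of the injective hull, and distinct σ give distinct vertices.
--
-- It then builds the split graph,
-- proves the facts above, and counts: with K = 3t + 4 and σ ranging over
-- the 2^(3t) sign vectors with a fixed balanced prefix of length 4, the
-- graph has n = 6(2t+3) vertices and 2^(3t) ≥ 2^(n/6) + 2n/3 - 2 hull
-- vertices once t ≥ 4 (lemma largeHull); the theorem takes t = 4 + m.

open import Defs
open import Data.Nat using (ℕ; _≤_)
open import Data.Product using (Σ; ∃; _×_)

open import Data.Nat using (zero; suc; _+_; _*_; _∸_; _^_; z≤n; s≤s)
open import Data.Nat.Properties
  using ( ≤-refl; ≤-reflexive; ≤-trans; module ≤-Reasoning; m≤m+n; m≤n+m; m≤m*n; m≤n⇒∃[o]m+o≡n
        ; +-mono-≤; +-monoʳ-≤; ^-monoʳ-≤; +-assoc; +-identityʳ; *-comm; *-suc; *-distribˡ-+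
        ; ^-*-assoc; m+n∸n≡m )
open import Data.Nat.Solver using (module +-*-Solver)
open import Data.Fin as Fin using (Fin; inject≤; finToFun; funToFin; combine)
open import Data.Fin.Properties using (_≟_; 2↔Bool; +↔⊎; *↔×; funToFin-finToFin; inject≤-injective)
open import Data.Bool using (Bool; true; false; not)
open import Data.Bool.Properties using (not-¬; not-involutive)
open import Data.Sum using (_⊎_; inj₁; inj₂)
open import Data.Sum.Function.Propositional using (_⊎-↔_)
open import Data.Product using (_,_; proj₁)
open import Data.Product.Function.NonDependent.Propositional using (_×-↔_)
open import Data.Unit using (⊤; tt)
open import Data.Empty using (⊥; ⊥-elim)
open import Relation.Nullary using (¬_; yes; no)
open import Relation.Binary.PropositionalEquality
open import Function using (_∘_; _↔_; Inverse; mk↔ₛ′)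
open import Function.Properties.Inverse using (↔-refl; ↔-trans)

module OnVertexType {V : Set} (Adj : V → V → Set) where

  data Path : V → V → ℕ → Set where
    here : ∀ {v} → Path v v 0
    step : ∀ {v v' v'' j} → Adj v v' → Path v' v'' j → Path v v'' (suc j)

  Dist : V → V → ℕ → Set
  Dist v v' k = Path v v' k × (∀ j → Path v v' j → k ≤ j)

  Dominating : (V → ℕ) → Set
  Dominating f = ∀ v v' → ∃ λ j → Path v v' j × j ≤ f v + f v'

  Tight : (V → ℕ) → Set
  Tight f = ∀ v → ∃ λ v' → Dist v v' (f v + f v')

  twoStep : ∀ {v z v'} → Adj v z → Adj z v' → Path v v' 2
  twoStep a a' = step a (step a' here)

  length≥2 : ∀ {v v' j} → v ≢ v' → ¬ Adj v v' → Path v v' j → 2 ≤ j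
  length≥2 v≢v' _ here = ⊥-elim (v≢v' refl)
  length≥2 _ ¬adj (step a here) = ⊥-elim (¬adj a)
  length≥2 _ _ (step _ (step _ _)) = s≤s (s≤s z≤n)

  length≥3 : ∀ {v v' j} → v ≢ v' → ¬ Adj v v' →
             (∀ {z} → Adj v z → ¬ Adj z v') → Path v v' j → 3 ≤ j
  length≥3 v≢v' _ _ here = ⊥-elim (v≢v' refl)
  length≥3 _ ¬adj _ (step a here) = ⊥-elim (¬adj a)
  length≥3 _ _ noCommon (step a (step a' here)) = ⊥-elim (noCommon a a')
  length≥3 _ _ _ (step _ (step _ (step _ _))) = s≤s (s≤s (s≤s z≤n))

  distance-two : ∀ {v z v'} → v ≢ v' → ¬ Adj v v' → Adj v z → Adj z v' → Dist v v' 2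
  distance-two v≢v' ¬adj a a' = twoStep a a' , λ j → length≥2 v≢v' ¬adj

  module Labelled (Adj-sym : ∀ {v v'} → Adj v v' → Adj v' v) (Adj-irr : ∀ {v} → ¬ Adj v v)
                  {n : ℕ} (labelling : Fin n ↔ V) where
    open Inverse labelling using (to; from; strictlyInverseˡ; strictlyInverseʳ)

    graph : Graph
    graph = record { n = n ; E = λ x y → Adj (to x) (to y) ; E-sym = Adj-sym ; E-irr = Adj-irr }

    walk→path : ∀ {x y j} → Walk graph x y j → Path (to x) (to y) j
    walk→path here = here
    walk→path (step e wk) = step e (walk→path wk)

    path→walk : ∀ {v v' j} → Path v v' j → Walk graph (from v) (from v') j
    path→walk here = here
    path→walk {v} (step {v' = z} a p) =
      step (subst₂ Adj (sym (strictlyInverseˡ v)) (sym (strictlyInverseˡ z)) a) (path→walk p)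

    path→walk′ : ∀ {x y j} → Path (to x) (to y) j → Walk graph x y j
    path→walk′ {x} {y} p = subst₂ (λ a b → Walk graph a b _) (strictlyInverseʳ x) (strictlyInverseʳ y) (path→walk p)

    connected : (∀ v v' → ∃ λ j → Path v v' j) → Connected graph
    connected reach x y = let (j , p) = reach (to x) (to y) in j , path→walk′ p

    split : (clique? : V → Bool) →
            (∀ v v' → clique? v ≡ true → clique? v' ≡ true → v ≢ v' → Adj v v') →
            (∀ v v' → clique? v ≡ false → clique? v' ≡ false → ¬ Adj v v') →
            IsSplit graph
    split clique? clique independent =
        clique? ∘ to
      , (λ x y cx cy x≢y → clique (to x) (to y) cx cy (x≢y ∘ injective))
      , (λ x y → independent (to x) (to y))
      where
        injective : ∀ {x y} → to x ≡ to y → x ≡ y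
        injective {x} {y} eq = trans (sym (strictlyInverseʳ x)) (trans (cong from eq) (strictlyInverseʳ y))

    hullVertex : ∀ {f} → Dominating f → Tight f → HullVertex graph (f ∘ to)
    hullVertex {f} dominating tight = lowerBound , partner
      where
        lowerBound : ∀ x y k → IsDist graph x y k → k ≤ f (to x) + f (to y)
        lowerBound x y k (_ , minimal) =
          let (j , p , j≤) = dominating (to x) (to y) in ≤-trans (minimal j (path→walk′ p)) j≤
        partner : ∀ x → ∃ λ y → IsDist graph x y (f (to x) + f (to y))
        partner x =
          let (v' , p , minimal) = tight (to x)
              back = strictlyInverseˡ v'
          in from v'
           , subst (IsDist graph x (from v')) (cong (λ z → f (to x) + f z) (sym back))
               ( path→walk′ (subst (λ z → Path (to x) z (f (to x) + f v')) (sym back) p)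
               , λ j wk → minimal j (subst (λ z → Path (to x) z j) back (walk→path wk)))

    hullSize : ∀ {N} (F : Fin N → V → ℕ) → (∀ i → Dominating (F i)) → (∀ i → Tight (F i)) →
               (∀ i j → (∀ v → F i v ≡ F j v) → i ≡ j) → HullSizeAtLeast graph N
    hullSize F dominating tight injective =
        (λ i → F i ∘ to)
      , (λ i → hullVertex {F i} (dominating i) (tight i))
      , λ i j eq → injective i j (agree eq)
      where
        agree : ∀ {f f' : V → ℕ} → (∀ x → f (to x) ≡ f' (to x)) → ∀ v → f v ≡ f' v
        agree {f} {f'} eq v = subst (λ z → f z ≡ f' z) (strictlyInverseˡ v) (eq (from v))

module SplitGraph (k : ℕ) where

  Index : Set
  Index = Fin (suc k)

  data V : Set where
    u : Bool → V
    s : Index → Bool → V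
    w : Index → Bool → V

  Matches : Index → Bool → Index → Bool → Set
  Matches i ε j δ = (i ≡ j × δ ≡ ε) ⊎ (i ≢ j × δ ≡ not ε)

  Adj : V → V → Set
  Adj (u δ) (u δ') = δ ≢ δ'
  Adj (u δ) (w _ _) = ⊤
  Adj (u δ) (s _ ε) = ε ≡ δ
  Adj (w _ _) (u _) = ⊤
  Adj (w j δ) (w j' δ') = w j δ ≢ w j' δ'
  Adj (w j δ) (s i ε) = Matches i ε j δ
  Adj (s _ ε) (u δ) = ε ≡ δ
  Adj (s i ε) (w j δ) = Matches i ε j δ
  Adj (s _ _) (s _ _) = ⊥

  Adj-sym : ∀ {v v'} → Adj v v' → Adj v' v
  Adj-sym {u _} {u _} a = a ∘ sym
  Adj-sym {u _} {w _ _} a = tt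
  Adj-sym {u _} {s _ _} a = a
  Adj-sym {w _ _} {u _} a = tt
  Adj-sym {w _ _} {w _ _} a = a ∘ sym
  Adj-sym {w _ _} {s _ _} a = a
  Adj-sym {s _ _} {u _} a = a
  Adj-sym {s _ _} {w _ _} a = a

  Adj-irr : ∀ {v} → ¬ Adj v v
  Adj-irr {u _} a = a refl
  Adj-irr {w _ _} a = a refl
  Adj-irr {s _ _} ()

  inClique : V → Bool
  inClique (s _ _) = false
  inClique _ = true

  clique : ∀ v v' → inClique v ≡ true → inClique v' ≡ true → v ≢ v' → Adj v v'
  clique (u _) (u _) _ _ v≢v' = v≢v' ∘ cong u
  clique (u _) (w _ _) _ _ _ = tt
  clique (w _ _) (u _) _ _ _ = tt
  clique (w _ _) (w _ _) _ _ v≢v' = v≢v'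

  independent : ∀ v v' → inClique v ≡ false → inClique v' ≡ false → ¬ Adj v v'
  independent (s _ _) (s _ _) _ _ ()

  -- V is the disjoint union of the u's and two copies of Index × Bool,
  -- which the library identifies with Fin (2 + (K·2 + K·2)).
  V↔parts : (Bool ⊎ ((Index × Bool) ⊎ (Index × Bool))) ↔ V
  V↔parts = mk↔ₛ′ assemble disassemble assemble∘disassemble disassemble∘assemble
    where
      assemble : Bool ⊎ ((Index × Bool) ⊎ (Index × Bool)) → V
      assemble (inj₁ δ) = u δ
      assemble (inj₂ (inj₁ (i , ε))) = s i ε
      assemble (inj₂ (inj₂ (j , δ))) = w j δ
      disassemble : V → Bool ⊎ ((Index × Bool) ⊎ (Index × Bool))
      disassemble (u δ) = inj₁ δ
      disassemble (s i ε) = inj₂ (inj₁ (i , ε))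
      disassemble (w j δ) = inj₂ (inj₂ (j , δ))
      assemble∘disassemble : ∀ v → assemble (disassemble v) ≡ v
      assemble∘disassemble (u _) = refl
      assemble∘disassemble (s _ _) = refl
      assemble∘disassemble (w _ _) = refl
      disassemble∘assemble : ∀ p → disassemble (assemble p) ≡ p
      disassemble∘assemble (inj₁ _) = refl
      disassemble∘assemble (inj₂ (inj₁ _)) = refl
      disassemble∘assemble (inj₂ (inj₂ _)) = refl

  size : ℕ
  size = 2 + (suc k * 2 + suc k * 2)

  labelling : Fin size ↔ V
  labelling = ↔-trans +↔⊎ (↔-trans (2↔Bool ⊎-↔ (↔-trans +↔⊎ (signed ⊎-↔ signed))) V↔parts)
    where
      signed : Fin (suc k * 2) ↔ (Index × Bool)
      signed = ↔-trans *↔× (↔-refl ×-↔ 2↔Bool)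

  open OnVertexType Adj public
  open Labelled Adj-sym Adj-irr labelling public

  isSplit : IsSplit graph
  isSplit = split inClique clique independent

  data Antipodal : V → V → Set where
    antipodal : ∀ i ε → Antipodal (s i ε) (s i (not ε))

  s-sign-injective : ∀ {i j ε δ} → s i ε ≡ s j δ → ε ≡ δ
  s-sign-injective refl = refl

  matches-opposite : ∀ {i ε j δ} → Matches i ε j δ → ¬ Matches i (not ε) j δ
  matches-opposite (inj₁ (_ , δ≡ε)) (inj₁ (_ , δ≡¬ε)) = not-¬ refl (trans (sym δ≡ε) δ≡¬ε)
  matches-opposite (inj₁ (i≡j , _)) (inj₂ (i≢j , _)) = i≢j i≡j
  matches-opposite (inj₂ (i≢j , _)) (inj₁ (i≡j , _)) = i≢j i≡j
  matches-opposite (inj₂ (_ , δ≡¬ε)) (inj₂ (_ , δ≡¬¬ε)) = not-¬ refl (trans (sym δ≡¬ε) δ≡¬¬ε)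

  -- Antipodal vertices are at distance exactly 3 (through u_ε and u_¬ε).
  antipodal-distance : ∀ {v v'} → Antipodal v v' → Dist v v' 3
  antipodal-distance (antipodal i ε) =
      step {v' = u ε} refl (step {v' = u (not ε)} (not-¬ refl) (step refl here))
    , λ j → length≥3 (not-¬ refl ∘ s-sign-injective) (λ ()) noCommonNeighbour
    where
      noCommonNeighbour : ∀ {z} → Adj (s i ε) z → ¬ Adj z (s i (not ε))
      noCommonNeighbour {u _} ε≡δ ¬ε≡δ = not-¬ refl (trans ε≡δ (sym ¬ε≡δ))
      noCommonNeighbour {w _ _} m m' = matches-opposite m m'

  oppositeSigns : ∀ i i' ε → Antipodal (s i ε) (s i' (not ε)) ⊎ ∃ λ z → Adj (s i ε) z × Adj z (s i' (not ε))
  oppositeSigns i i' ε with i ≟ i'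
  ... | yes refl = inj₁ (antipodal i ε)
  ... | no i≢i' = inj₂ (w i ε , inj₁ (refl , refl) , inj₂ (i≢i' ∘ sym , sym (not-involutive ε)))

  commonNeighbour : ∀ v v' → Antipodal v v' ⊎ ∃ λ z → Adj v z × Adj z v'
  commonNeighbour (u δ) (u δ') = inj₂ (w Fin.zero true , tt , tt)
  commonNeighbour (u δ) (w _ _) = inj₂ (u (not δ) , not-¬ refl , tt)
  commonNeighbour (u δ) (s i ε) = inj₂ (w i ε , tt , inj₁ (refl , refl))
  commonNeighbour (w _ _) (u δ') = inj₂ (u (not δ') , tt , not-¬ refl ∘ sym)
  commonNeighbour (w _ _) (w _ _) = inj₂ (u true , tt , tt)
  commonNeighbour (w _ _) (s i ε) = inj₂ (u ε , tt , refl)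
  commonNeighbour (s i ε) (u _) = inj₂ (w i ε , inj₁ (refl , refl) , tt)
  commonNeighbour (s _ ε) (w _ _) = inj₂ (u ε , refl , tt)
  commonNeighbour (s _ true) (s _ true) = inj₂ (u true , refl , refl)
  commonNeighbour (s _ false) (s _ false) = inj₂ (u false , refl , refl)
  commonNeighbour (s i true) (s i' false) = oppositeSigns i i' true
  commonNeighbour (s i false) (s i' true) = oppositeSigns i i' false

  reachable : ∀ v v' → ∃ λ j → Path v v' j
  reachable v v' with commonNeighbour v v'
  ... | inj₁ opposite = 3 , proj₁ (antipodal-distance opposite)
  ... | inj₂ (_ , a , a') = 2 , twoStep a a'

  isConnected : Connected graph
  isConnected = connected reachable

  -- The value of a hull function at s(i,ε) when σᵢ = a: 1 if ε = a, else 2.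
  weight : Bool → Bool → ℕ
  weight true true = 1
  weight false false = 1
  weight true false = 2
  weight false true = 2

  weight-same : ∀ a → weight a a ≡ 1
  weight-same true = refl
  weight-same false = refl

  weight-opposite : ∀ a ε → weight a ε + weight a (not ε) ≡ 3
  weight-opposite true true = refl
  weight-opposite true false = refl
  weight-opposite false true = refl
  weight-opposite false false = refl

  weight-positive : ∀ a ε → 1 ≤ weight a ε
  weight-positive true true = s≤s z≤n
  weight-positive true false = s≤s z≤n
  weight-positive false true = s≤s z≤n
  weight-positive false false = s≤s z≤n

  weight-injective : ∀ a a' → weight a true ≡ weight a' true → a ≡ a'
  weight-injective true true _ = refl
  weight-injective false false _ = refl

  hullFunction : (Index → Bool) → V → ℕ
  hullFunction σ (s i ε) = weight (σ i) ε
  hullFunction σ (u _) = 1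
  hullFunction σ (w _ _) = 1

  hullFunction-positive : ∀ σ v → 1 ≤ hullFunction σ v
  hullFunction-positive σ (s i ε) = weight-positive (σ i) ε
  hullFunction-positive σ (u _) = ≤-refl
  hullFunction-positive σ (w _ _) = ≤-refl

  matched : ∀ σ {i ε} → σ i ≡ ε → hullFunction σ (s i ε) ≡ 1
  matched σ {ε = ε} σi≡ε = trans (cong (λ a → weight a ε) σi≡ε) (weight-same ε)

  -- Common neighbours give walks of length 2 ≤ f(v) + f(v'); antipodal
  -- pairs are at distance 3 = f(v) + f(v').
  dominating : ∀ σ → Dominating (hullFunction σ)
  dominating σ v v' with commonNeighbour v v'
  ... | inj₁ (antipodal i ε) =
    3 , proj₁ (antipodal-distance (antipodal i ε)) , ≤-reflexive (sym (weight-opposite (σ i) ε))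
  ... | inj₂ (_ , a , a') =
    2 , twoStep a a' , +-mono-≤ (hullFunction-positive σ v) (hullFunction-positive σ v')

  Balanced : (Index → Bool) → Set
  Balanced σ = ∀ j δ → ∃ λ i → i ≢ j × σ i ≡ δ

  -- The partner of s(i,ε) is its antipode; u_δ and w(j,δ) are at distance 2
  -- from a vertex s(i,·) of weight 1 that balance provides.
  tight : ∀ σ → Balanced σ → Tight (hullFunction σ)
  tight σ _ (s i ε) =
    s i (not ε) , subst (Dist _ _) (sym (weight-opposite (σ i) ε)) (antipodal-distance (antipodal i ε))
  tight σ balanced (u δ) with balanced Fin.zero (not δ)
  ... | i , _ , σi≡¬δ =
    s i (not δ) , subst (Dist _ _) (cong suc (sym (matched σ σi≡¬δ)))
                    (distance-two {z = w i (not δ)} (λ ()) (not-¬ refl ∘ sym) tt (inj₁ (refl , refl)))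
  tight σ balanced (w j δ) with balanced j δ
  ... | i , i≢j , σi≡δ =
    s i δ , subst (Dist _ _) (cong suc (sym (matched σ σi≡δ)))
              (distance-two {z = u δ} (λ ()) notMatching tt refl)
    where
      notMatching : ¬ Matches i δ j δ
      notMatching (inj₁ (i≡j , _)) = i≢j i≡j
      notMatching (inj₂ (_ , δ≡¬δ)) = not-¬ refl δ≡¬δ

  hullFunction-determines : ∀ σ σ' → (∀ v → hullFunction σ v ≡ hullFunction σ' v) → ∀ i → σ i ≡ σ' i
  hullFunction-determines σ σ' eq i = weight-injective (σ i) (σ' i) (eq (s i true))

extend : ∀ {k'} → (Fin k' → Bool) → Fin (4 + k') → Bool
extend τ Fin.zero = false
extend τ (Fin.suc Fin.zero) = false
extend τ (Fin.suc (Fin.suc Fin.zero)) = true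
extend τ (Fin.suc (Fin.suc (Fin.suc Fin.zero))) = true
extend τ (Fin.suc (Fin.suc (Fin.suc (Fin.suc ℓ)))) = τ ℓ

extend-balanced : ∀ {k'} (τ : Fin k' → Bool) → SplitGraph.Balanced (3 + k') (extend τ)
extend-balanced τ Fin.zero false = Fin.suc Fin.zero , (λ ()) , refl
extend-balanced τ (Fin.suc _) false = Fin.zero , (λ ()) , refl
extend-balanced τ Fin.zero true = Fin.suc (Fin.suc Fin.zero) , (λ ()) , refl
extend-balanced τ (Fin.suc Fin.zero) true = Fin.suc (Fin.suc Fin.zero) , (λ ()) , refl
extend-balanced τ (Fin.suc (Fin.suc Fin.zero)) true = Fin.suc (Fin.suc (Fin.suc Fin.zero)) , (λ ()) , refl
extend-balanced τ (Fin.suc (Fin.suc (Fin.suc _))) true = Fin.suc (Fin.suc Fin.zero) , (λ ()) , refl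

binaryWord : ∀ {N k} → N ≤ 2 ^ k → Fin N → Fin k → Bool
binaryWord {k = k} N≤ i = Inverse.to 2↔Bool ∘ finToFun {2} {k} (inject≤ i N≤)

binaryWord-injective : ∀ {N k} (N≤ : N ≤ 2 ^ k) i j →
                       (∀ ℓ → binaryWord N≤ i ℓ ≡ binaryWord N≤ j ℓ) → i ≡ j
binaryWord-injective {k = k} N≤ i j eq = inject≤-injective N≤ N≤ i j (begin
    inject≤ i N≤                                       ≡⟨ sym (funToFin-finToFin {k} (inject≤ i N≤)) ⟩
    funToFin (finToFun {2} {k} (inject≤ i N≤))         ≡⟨ funToFin-cong digitsAgree ⟩
    funToFin (finToFun {2} {k} (inject≤ j N≤))         ≡⟨ funToFin-finToFin {k} (inject≤ j N≤) ⟩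
    inject≤ j N≤                                       ∎)
  where
    open ≡-Reasoning
    open Inverse 2↔Bool using (from; strictlyInverseʳ)
    digitsAgree : ∀ ℓ → finToFun {2} {k} (inject≤ i N≤) ℓ ≡ finToFun (inject≤ j N≤) ℓ
    digitsAgree ℓ = trans (sym (strictlyInverseʳ _)) (trans (cong from (eq ℓ)) (strictlyInverseʳ _))
    funToFin-cong : ∀ {m} {f f' : Fin m → Fin 2} → (∀ x → f x ≡ f' x) → funToFin f ≡ funToFin f'
    funToFin-cong {zero} _ = refl
    funToFin-cong {suc m} eq′ = cong₂ combine (eq′ Fin.zero) (funToFin-cong (eq′ ∘ Fin.suc))

manyHullVertices : ∀ k' {N} → N ≤ 2 ^ k' → HullSizeAtLeast (SplitGraph.graph (3 + k')) N
manyHullVertices k' N≤ = hullSize F (λ i → dominating (σ i)) (λ i → tight (σ i) (extend-balanced _)) injective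
  where
    open SplitGraph (3 + k')
    σ : Fin _ → Index → Bool
    σ i = extend (binaryWord N≤ i)
    F : Fin _ → V → ℕ
    F i = hullFunction (σ i)
    injective : ∀ i j → (∀ v → F i v ≡ F j v) → i ≡ j
    injective i j eq = binaryWord-injective N≤ i j
      (λ ℓ → hullFunction-determines (σ i) (σ j) eq (Fin.suc (Fin.suc (Fin.suc (Fin.suc ℓ)))))

open +-*-Solver

exactBound : ∀ j N → N + 2 ≡ 2 ^ j + 4 * j → BoundHolds (6 * j) N
exactBound j N N+2≡ = subst (2 * (6 * j) ≤_) (sym slack) (m≤n+m (2 * (6 * j)) (3 * p)) , sixthPower
  where
    p = 2 ^ j
    slack : 3 * N + 6 ≡ 3 * p + 2 * (6 * j)
    slack = begin
      3 * N + 6           ≡⟨ sym (*-distribˡ-+ 3 N 2) ⟩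
      3 * (N + 2)         ≡⟨ cong (3 *_) N+2≡ ⟩
      3 * (p + 4 * j)     ≡⟨ solve 2 (λ p j → con 3 :* (p :+ con 4 :* j) := con 3 :* p :+ con 2 :* (con 6 :* j)) refl p j ⟩
      3 * p + 2 * (6 * j) ∎
      where open ≡-Reasoning
    sixthPower : 729 * 2 ^ (6 * j) ≤ (3 * N + 6 ∸ 2 * (6 * j)) ^ 6
    sixthPower = ≤-reflexive (begin
      729 * 2 ^ (6 * j)            ≡⟨ cong (729 *_) (trans (cong (2 ^_) (*-comm 6 j)) (sym (^-*-assoc 2 j 6))) ⟩
      729 * p ^ 6                  ≡⟨ solve 1 (λ p → con 729 :* p :^ 6 := (con 3 :* p) :^ 6) refl p ⟩
      (3 * p) ^ 6                  ≡⟨ cong (_^ 6) (sym (m+n∸n≡m (3 * p) (2 * (6 * j)))) ⟩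
      (3 * p + 2 * (6 * j) ∸ 2 * (6 * j)) ^ 6 ≡⟨ cong (λ z → (z ∸ 2 * (6 * j)) ^ 6) (sym slack) ⟩
      (3 * N + 6 ∸ 2 * (6 * j)) ^ 6 ∎)
      where open ≡-Reasoning

fourFold≤power : ∀ j → 4 ≤ j → 4 * j ≤ 2 ^ j
fourFold≤power j 4≤j with m≤n⇒∃[o]m+o≡n 4≤j
... | i , refl = fromFour i
  where
    fromFour : ∀ i → 4 * (4 + i) ≤ 2 ^ (4 + i)
    fromFour zero = ≤-refl
    fromFour (suc i) = begin
        4 * suc (4 + i)          ≡⟨ *-suc 4 (4 + i) ⟩
        4 + 4 * (4 + i)          ≤⟨ +-mono-≤ (≤-trans (m≤m*n 4 (4 + i)) ih) ih ⟩
        p + p                    ≡⟨ cong (p +_) (sym (+-identityʳ p)) ⟩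
        2 ^ (4 + suc i)          ∎
      where
        open ≤-Reasoning
        p = 2 ^ (4 + i)
        ih = fromFour i

-- The bound 2^(n/6) + 2n/3 − 2 of the theorem for n = 6(2t + 3).
required : ℕ → ℕ
required t = 2 ^ (2 * t + 3) + (8 * t + 10)

required-meets-bound : ∀ t → BoundHolds (6 * (2 * t + 3)) (required t)
required-meets-bound t = exactBound j (required t)
    (trans (+-assoc (2 ^ j) (8 * t + 10) 2) (cong (2 ^ j +_)
      (solve 1 (λ t → con 8 :* t :+ con 10 :+ con 2 := con 4 :* (con 2 :* t :+ con 3)) refl t)))
  where
    j = 2 * t + 3

-- For t ≥ 4 there are at least that many words of length 3t:
-- 2^j + 4j − 2 ≤ 2^(j+1) ≤ 2^(3t) for j = 2t + 3.
enoughWords : ∀ t → 4 ≤ t → required t ≤ 2 ^ (3 * t)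
enoughWords t 4≤t = begin
    2 ^ j + (8 * t + 10)     ≤⟨ +-monoʳ-≤ (2 ^ j) (≤-trans linear (fourFold≤power j 4≤j)) ⟩
    2 ^ j + 2 ^ j            ≡⟨ cong (2 ^ j +_) (sym (+-identityʳ (2 ^ j))) ⟩
    2 ^ suc j                ≤⟨ ^-monoʳ-≤ 2 exponent ⟩
    2 ^ (3 * t)              ∎
  where
    open ≤-Reasoning
    j = 2 * t + 3
    4≤j : 4 ≤ j
    4≤j = ≤-trans 4≤t (≤-trans (m≤m+n t (t + 3)) (≤-reflexive
            (solve 1 (λ t → t :+ (t :+ con 3) := con 2 :* t :+ con 3) refl t)))
    linear : 8 * t + 10 ≤ 4 * j
    linear = ≤-trans (m≤m+n (8 * t + 10) 2) (≤-reflexive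
               (solve 1 (λ t → con 8 :* t :+ con 10 :+ con 2 := con 4 :* (con 2 :* t :+ con 3)) refl t))
    exponent : suc j ≤ 3 * t
    exponent = begin
      suc j      ≡⟨ solve 1 (λ t → con 1 :+ (con 2 :* t :+ con 3) := con 2 :* t :+ con 4) refl t ⟩
      2 * t + 4  ≤⟨ +-monoʳ-≤ (2 * t) 4≤t ⟩
      2 * t + t  ≡⟨ solve 1 (λ t → con 2 :* t :+ t := con 3 :* t) refl t ⟩
      3 * t      ∎

-- For t ≥ 4 the split graph on 3t + 4 indices, with n = 6(2t + 3) ≥ t
-- vertices, has at least 2^(n/6) + 2n/3 − 2 hull vertices.  (Keeping t a
-- variable here spares the type checker from unfolding 2^n on numerals.)
largeHull : ∀ m t → m ≤ t → 4 ≤ t → Σ Graph λ G → (m ≤ n G) × Connected G × IsSplit G ×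
              ∃ λ N → HullSizeAtLeast G N × BoundHolds (n G) N
largeHull m t m≤t 4≤t =
    graph , subst (m ≤_) (sym size≡) (≤-trans m≤t t≤6[2t+3]) , isConnected , isSplit
  , required t , manyHullVertices (3 * t) (enoughWords t 4≤t)
  , subst (λ k → BoundHolds k (required t)) (sym size≡) (required-meets-bound t)
  where
    open SplitGraph (3 + 3 * t)
    size≡ : n graph ≡ 6 * (2 * t + 3)
    size≡ = solve 1 (λ t → con 2 :+ ((con 4 :+ con 3 :* t) :* con 2 :+ (con 4 :+ con 3 :* t) :* con 2)
                             := con 6 :* (con 2 :* t :+ con 3)) refl t
    t≤6[2t+3] : t ≤ 6 * (2 * t + 3)
    t≤6[2t+3] = ≤-trans (m≤m+n t (11 * t + 18)) (≤-reflexive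
                  (solve 1 (λ t → t :+ (con 11 :* t :+ con 18) := con 6 :* (con 2 :* t :+ con 3)) refl t))

theorem6 : ∀ (m : ℕ) → Σ Graph λ G → (m ≤ n G) × Connected G × IsSplit G ×
    ∃ λ N → HullSizeAtLeast G N × BoundHolds (n G) N
-- Take t = 4 + m.
theorem6 m = largeHull m (4 + m) (m≤n+m m 4) (m≤m+n 4 m)
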